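{- If $k\ge 3$ and $\sigma\in S_k$ has exactly one descent, then for every $n\in\mathbb{N}$, \[ |\mathscr{G}_n(\sigma)| = 1+\sum_{j=3}^{k}\binom{n}{j-1}. \]
   Context: A descent of a permutation $\pi$ is a position $i$ with $\pi(i)>\pi(i+1)$. A permutation is Grassmannian if it has at most one descent; $\mathscr{G}_n$ is the set of Grassmannian permutations of $[n]$, and $\mathscr{G}_n(\sigma)$ is the subset of those avoiding the classical pattern $\sigma$ (no subsequence order-isomorphic to $\sigma$). -}

module Defs where

open import Data.Nat using (ℕ; zero; suc; _+_; _∸_; _<_; _≤_; _<?_; _≤?_; _≟_)
open import Data.Nat.Combinatorics using (_C_)
open import Data.Fin using (Fin; toℕ; inject₁) renaming (suc to fsuc; _≟_ to _≟ᶠ_)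
open import Data.Fin.Properties using (all?; any?)
open import Data.Vec using (Vec; []; _∷_; lookup)
open import Data.List using (List; []; _∷_; concatMap; map; length; filter; allFin; upTo)
open import Data.Nat.ListAction using (sum)
open import Data.Product using (_×_; ∃; _,_; proj₁; proj₂)
open import Relation.Nullary using (Dec; ¬_; yes; no)
open import Relation.Nullary.Decidable using (_×-dec_; ¬?; _→-dec_)
open import Relation.Binary.PropositionalEquality using (_≡_; refl)
import Data.List.Relation.Unary.Any as Any
open import Data.List.Membership.Propositional using (_∈_)
open import Data.List.Membership.Propositional.Properties using (∈-concatMap⁺; ∈-map⁺; ∈-allFin)

-- A word of length k over the alphabet Fin n, in one-line notation
-- (position i ↦ lookup w i).  Values 0..n-1 stand for 1..n.
Word : ℕ → ℕ → Set
Word k n = Vec (Fin n) k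

allWords : (k n : ℕ) → List (Word k n)
allWords zero    n = [] ∷ []
allWords (suc k) n = concatMap (λ w → map (λ a → a ∷ w) (allFin n)) (allWords k n)

IsPerm : ∀ {n} → Word n n → Set
IsPerm {n} w = ∀ (i j : Fin n) → lookup w i ≡ lookup w j → i ≡ j

isPerm? : ∀ {n} (w : Word n n) → Dec (IsPerm w)
isPerm? {n} w = all? (λ i → all? (λ j → (lookup w i ≟ᶠ lookup w j) →-dec (i ≟ᶠ j)))

IsDescentAt : ∀ {k n} → Word k n → Fin k → Set
IsDescentAt {k} w p =
  ∃ λ (q : Fin k) → (toℕ q ≡ suc (toℕ p)) × (toℕ (lookup w q) < toℕ (lookup w p))

isDescentAt? : ∀ {k n} (w : Word k n) (p : Fin k) → Dec (IsDescentAt w p)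
isDescentAt? w p = any? (λ q → (toℕ q ≟ suc (toℕ p)) ×-dec (toℕ (lookup w q) <? toℕ (lookup w p)))

des : ∀ {k n} → Word k n → ℕ
des {k} w = length (filter (isDescentAt? w) (allFin k))

IsGrassmannian : ∀ {k n} → Word k n → Set
IsGrassmannian w = des w ≤ 1

Occurrence : ∀ {k n} → Word k k → Word n n → Word k n → Set
Occurrence {k} σ π ι =
  (∀ (a b : Fin k) → toℕ a < toℕ b → toℕ (lookup ι a) < toℕ (lookup ι b)) ×
  (∀ (a b : Fin k) →
     (toℕ (lookup π (lookup ι a)) < toℕ (lookup π (lookup ι b)) → toℕ (lookup σ a) < toℕ (lookup σ b)) ×
     (toℕ (lookup σ a) < toℕ (lookup σ b) → toℕ (lookup π (lookup ι a)) < toℕ (lookup π (lookup ι b))))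

occurrence? : ∀ {k n} (σ : Word k k) (π : Word n n) (ι : Word k n) → Dec (Occurrence σ π ι)
occurrence? σ π ι =
  all? (λ a → all? (λ b → (toℕ a <? toℕ b) →-dec (toℕ (lookup ι a) <? toℕ (lookup ι b))))
  ×-dec
  all? (λ a → all? (λ b →
     (((toℕ (lookup π (lookup ι a)) <? toℕ (lookup π (lookup ι b))) →-dec (toℕ (lookup σ a) <? toℕ (lookup σ b)))
      ×-dec
      ((toℕ (lookup σ a) <? toℕ (lookup σ b)) →-dec (toℕ (lookup π (lookup ι a)) <? toℕ (lookup π (lookup ι b)))))))

allWords-complete : ∀ {k n} (ι : Word k n) → ι ∈ allWords k n
allWords-complete {zero}  [] = Any.here refl
allWords-complete {suc k} (a ∷ ι) =
  ∈-concatMap⁺ (λ w → map (λ b → b ∷ w) (allFin _)) (Any.map (λ { refl → ∈-map⁺ (λ b → b ∷ ι) (∈-allFin a) }) (allWords-complete ι))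

Contains : ∀ {k n} → Word k k → Word n n → Set
Contains {k} {n} σ π = ∃ λ (ι : Word k n) → Occurrence σ π ι

contains? : ∀ {k n} (σ : Word k k) (π : Word n n) → Dec (Contains σ π)
contains? {k} {n} σ π with Any.any? (occurrence? σ π) (allWords k n)
... | yes p = yes (proj₁ (Any.satisfied p) , proj₂ (Any.satisfied p))
... | no ¬p = no (λ { (ι , o) → ¬p (Any.map (λ { refl → o }) (allWords-complete ι)) })

Avoids : ∀ {k n} → Word k k → Word n n → Set
Avoids σ π = ¬ Contains σ π

-- 𝒢_n(σ) : Grassmannian permutations of [n] avoiding σ, as a list obtained by
-- filtering the (duplicate-free) enumeration of all words of length n.
InGnσ : ∀ {k n} → Word k k → Word n n → Set
InGnσ σ π = IsPerm π × IsGrassmannian π × Avoids σ π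

inGnσ? : ∀ {k n} (σ : Word k k) (π : Word n n) → Dec (InGnσ σ π)
inGnσ? σ π = isPerm? π ×-dec (des π ≤? 1) ×-dec ¬? (contains? σ π)

Gnσ : ∀ {k} (n : ℕ) → Word k k → List (Word n n)
Gnσ n σ = filter (inGnσ? σ) (allWords n n)

-- ∑_{j=a}^{b} f j  (empty sum = 0 when b < a)
sumFromTo : ℕ → ℕ → (ℕ → ℕ) → ℕ
sumFromTo a b f = sum (map (λ i → f (a + i)) (upTo (suc b ∸ a)))

-- A Grassmannian permutation π with its descent at d is determined by the set of values in
-- positions ≤ d: labelling these values 0 and the others 1, π lists the 0-labelled values in
-- increasing order followed by the 1-labelled ones, i.e. it sorts [n] by the key (label, value).
-- Conversely every binary labelling of [n] sorts [n] into a Grassmannian permutation, and two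
-- labellings give the same permutation only if both have the form 0…01…1 (the identity).  So
-- Grassmannian permutations correspond to the 2ⁿ − n "canonical" labellings: those with a 1
-- before a 0, together with 0…0.
-- If σ has exactly one descent its labelling u has a 1 before a 0, hence is determined by σ,
-- and σ occurs in π exactly when u is a subsequence of the labelling of π.  Binary words of
-- length n avoiding a fixed word of length k as a subsequence number Σ_{i<k} C(n,i) (Pascal's
-- rule on the first letter), and none of the n non-canonical labellings contains u, so
-- |𝒢ₙ(σ)| = Σ_{i<k} C(n,i) − n = 1 + Σ_{j=3}^{k} C(n,j−1).

module Submission where

open import Defs
open import Algebra.Properties.CommutativeSemigroup using (interchange)
open import Data.Bool using (Bool; true; false; not; _∧_; _∨_; if_then_else_; T)
open import Data.Bool.Properties using (T-∨; T-∧; ∨-identityʳ; ∧-zeroʳ)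
open import Data.Empty using (⊥-elim)
open import Data.Fin using (Fin; zero; suc; toℕ; fromℕ<; inject₁; punchOut)
  renaming (_<_ to _<ᶠ_; _≤_ to _≤ᶠ_; _≟_ to _≟ᶠ_)
open import Data.Fin.Patterns using (0F; 1F)
open import Data.Fin.Properties
  using ( 0≢1+n; any?; pigeonhole; punchOut-injective; toℕ-injective; toℕ<n; toℕ-fromℕ<; toℕ-inject₁
        ; ≤̄⇒inject₁<)
  renaming (<-cmp to <ᶠ-cmp)
open import Data.List using (List; []; _∷_; length; map; filter; allFin; concatMap; applyUpTo)
open import Data.List.Properties using (length-map; length-tabulate; map-applyUpTo)
open import Data.List.Membership.Propositional using (_∈_)
open import Data.List.Membership.Propositional.Properties
  using (∈-filter⁺; ∈-filter⁻; ∈-allFin; ∈-map⁺; ∈-map⁻; ∈-concatMap⁻)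
open import Data.List.Membership.Propositional.Properties.WithK using (unique∧set⇒bag)
open import Data.List.Relation.Binary.BagAndSetEquality using (∼bag⇒↭)
open import Data.List.Relation.Binary.Permutation.Propositional.Properties using (↭-length)
open import Data.List.Relation.Unary.All as All using ([]; _∷_)
import Data.List.Relation.Unary.All.Properties as All
open import Data.List.Relation.Unary.AllPairs using ([]; _∷_)
open import Data.List.Relation.Unary.Any as Any using (here; there)
open import Data.List.Relation.Unary.Unique.Propositional using (Unique)
open import Data.List.Relation.Unary.Unique.Propositional.Properties using (filter⁺; allFin⁺; ++⁺; map⁺)
open import Data.Nat using (ℕ; zero; suc; _+_; _∸_; _<_; _≤_; z≤n; s≤s; _<?_; _≤?_)
open import Data.Nat.Combinatorics using (_C_; nCk+nC[k+1]≡[n+1]C[k+1]; nC1≡n)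
open import Data.Nat.ListAction using (sum)
open import Data.Nat.Properties
  using ( <-irrefl; <-asym; <-trans; <-cmp; ≤-refl; ≤-reflexive; ≤-trans; ≤-antisym; ≤-<-trans; ≤-pred
        ; n<1+n; n≤1+n; m≤n+m; m≤n⇒m≤1+n; m≤n⇒m<n∨m≡n
        ; <⇒≤; <⇒≢; <⇒≱; ≰⇒>; ≮⇒≥; ≤∧≢⇒<; 1+n≢n
        ; +-suc; +-comm; m∸n+n≡m; +-cancelʳ-≡; +-commutativeSemigroup)
open import Data.Product using (∃; _×_; _,_; proj₁; proj₂)
open import Data.Sum using (_⊎_; inj₁; inj₂; [_,_]′)
open import Data.Vec using (Vec; []; _∷_; lookup; tabulate; replicate; tail)
open import Data.Vec.Properties
  using (lookup∘tabulate; tabulate∘lookup; tabulate-cong; lookup-replicate; ∷-injectiveˡ)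
open import Function using (_∘_)
open import Function.Bundles using (mk⇔; Equivalence)
open import Relation.Binary.Definitions using (tri<; tri≈; tri>; DecidableEquality)
open import Relation.Binary.PropositionalEquality
  using (_≡_; _≢_; refl; sym; trans; cong; cong₂; subst; subst₂; module ≡-Reasoning)
open import Relation.Nullary using (¬_; Dec; yes; no; does; contradiction)
open import Relation.Nullary.Decidable as Dec using (T?; ⌊_⌋; toWitness; fromWitness)

StrictlyIncreasing : ∀ {m n} → (Fin m → Fin n) → Set
StrictlyIncreasing f = ∀ i j → i <ᶠ j → f i <ᶠ f j

fin-injective⇒surjective : ∀ {n} (f : Fin n → Fin n) → (∀ i j → f i ≡ f j → i ≡ j) →
  ∀ y → ∃ λ x → f x ≡ y
fin-injective⇒surjective {suc m} f f-inj y with any? (λ x → f x ≟ᶠ y)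
... | yes found = found
... | no missed =
  let i , j , i<j , fi≈fj = pigeonhole (n<1+n m) (λ x → punchOut (avoids x))
  in ⊥-elim (<-irrefl (cong toℕ (f-inj i j (punchOut-injective (avoids i) (avoids j) fi≈fj))) i<j)
  where
  avoids : ∀ x → y ≢ f x
  avoids x y≡fx = missed (x , sym y≡fx)

increasing⇒≤ : ∀ {m n} (f : Fin m → Fin n) → StrictlyIncreasing f → ∀ i → toℕ i ≤ toℕ (f i)
increasing⇒≤ f f-inc zero    = z≤n
increasing⇒≤ f f-inc (suc i) =
  ≤-<-trans (increasing⇒≤ (f ∘ inject₁) f∘inject₁-inc i)
            (f-inc (inject₁ i) (suc i) (≤̄⇒inject₁< ≤-refl))
  where
  f∘inject₁-inc : StrictlyIncreasing (f ∘ inject₁)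
  f∘inject₁-inc a b a<b =
    f-inc (inject₁ a) (inject₁ b) (subst₂ _<_ (sym (toℕ-inject₁ a)) (sym (toℕ-inject₁ b)) a<b)

increasing⇒reflects : ∀ {m n} (f : Fin m → Fin n) → StrictlyIncreasing f → ∀ i j → f i <ᶠ f j → i <ᶠ j
increasing⇒reflects f f-inc i j fi<fj with <ᶠ-cmp i j
... | tri< i<j _ _  = i<j
... | tri≈ _ refl _ = contradiction fi<fj (<-irrefl refl)
... | tri> _ _ j<i  = contradiction (f-inc j i j<i) (<-asym fi<fj)

increasing-section⇒id : ∀ {n} (f g : Fin n → Fin n) → StrictlyIncreasing f → StrictlyIncreasing g →
  (∀ i → g (f i) ≡ i) → ∀ i → f i ≡ i
increasing-section⇒id f g f-inc g-inc g∘f≗id i = toℕ-injective (≤-antisym fi≤i (increasing⇒≤ f f-inc i))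
  where
  fi≤i : toℕ (f i) ≤ toℕ i
  fi≤i = subst (λ j → toℕ (f i) ≤ toℕ j) (g∘f≗id i) (increasing⇒≤ g g-inc (f i))

lookup-ext : ∀ {A : Set} {n} (u v : Vec A n) → (∀ i → lookup u i ≡ lookup v i) → u ≡ v
lookup-ext u v u≗v = trans (sym (tabulate∘lookup u)) (trans (tabulate-cong u≗v) (tabulate∘lookup v))

module _ {A : Set} where

  members-equal : ∀ {xs : List A} {x y} → length xs ≤ 1 → x ∈ xs → y ∈ xs → x ≡ y
  members-equal {_ ∷ []}    _        (here refl) (here refl) = refl
  members-equal {_ ∷ []}    _        (there ())  _
  members-equal {_ ∷ []}    _        (here _)    (there ())
  members-equal {_ ∷ _ ∷ _} (s≤s ()) _           _

  nonempty⇒∃∈ : ∀ {xs : List A} → 0 < length xs → ∃ λ x → x ∈ xs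
  nonempty⇒∃∈ {x ∷ _} _ = x , here refl

  members-equal⇒length≤1 : ∀ {xs : List A} → Unique xs → (∀ {x y} → x ∈ xs → y ∈ xs → x ≡ y) →
    length xs ≤ 1
  members-equal⇒length≤1 {[]}        _                   _  = z≤n
  members-equal⇒length≤1 {_ ∷ []}    _                   _  = s≤s z≤n
  members-equal⇒length≤1 {_ ∷ _ ∷ _} ((x≢y ∷ _) ∷ _) eq =
    contradiction (eq (here refl) (there (here refl))) x≢y

module _ {A B : Set} (f : A → B) where

  map-unique : ∀ {xs} → Unique xs → (∀ {x y} → x ∈ xs → y ∈ xs → f x ≡ f y → x ≡ y) →
    Unique (map f xs)
  map-unique {[]}     []          _     = []
  map-unique {x ∷ xs} (x∉ ∷ uniq) f-inj =
    All.map⁺ (All.tabulate (λ y∈ fx≡fy → All.lookup x∉ y∈ (f-inj (here refl) (there y∈) fx≡fy)))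
    ∷ map-unique uniq (λ x∈ y∈ → f-inj (there x∈) (there y∈))

  length-≡-by-bijection : ∀ {xs ys} → Unique xs → Unique ys →
    (∀ {x y} → x ∈ xs → y ∈ xs → f x ≡ f y → x ≡ y) →
    (∀ {x} → x ∈ xs → f x ∈ ys) → (∀ {y} → y ∈ ys → ∃ λ x → x ∈ xs × f x ≡ y) →
    length xs ≡ length ys
  length-≡-by-bijection {xs} {ys} xs-uniq ys-uniq f-inj into onto =
    trans (sym (length-map f xs))
      (↭-length (∼bag⇒↭ (unique∧set⇒bag (map-unique xs-uniq f-inj) ys-uniq (mk⇔ to from))))
    where
    to : ∀ {y} → y ∈ map f xs → y ∈ ys
    to y∈ with ∈-map⁻ f y∈
    ... | x , x∈ , refl = into x∈
    from : ∀ {y} → y ∈ ys → y ∈ map f xs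
    from y∈ with onto y∈
    ... | x , x∈ , refl = ∈-map⁺ f x∈

allWords-unique : ∀ k n → Unique (allWords k n)
allWords-unique zero    n = [] ∷ []
allWords-unique (suc k) n = extend-unique (allWords-unique k n)
  where
  extend : Word k n → List (Word (suc k) n)
  extend w = map (_∷ w) (allFin n)
  extend-unique : ∀ {ws} → Unique ws → Unique (concatMap extend ws)
  extend-unique {[]}     []         = []
  extend-unique {w ∷ ws} (w∉ ∷ uniq) =
    ++⁺ (map⁺ ∷-injectiveˡ (allFin⁺ n)) (extend-unique uniq) disjoint
    where
    tail∈ : ∀ {v} → v ∈ concatMap extend ws → tail v ∈ ws
    tail∈ v∈ =
      Any.map (λ v∈ext → cong tail (proj₂ (proj₂ (∈-map⁻ (_∷ _) v∈ext)))) (∈-concatMap⁻ extend v∈)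
    disjoint : ∀ {v} → ¬ (v ∈ extend w × v ∈ concatMap extend ws)
    disjoint (v∈ , v∈′) with ∈-map⁻ (_∷ w) v∈
    ... | _ , _ , refl = All.lookup w∉ (tail∈ v∈′) refl

module _ {A : Set} where

  count : (A → Bool) → List A → ℕ
  count p []       = 0
  count p (x ∷ xs) = if p x then suc (count p xs) else count p xs

  count-true : ∀ xs → count (λ _ → true) xs ≡ length xs
  count-true []       = refl
  count-true (_ ∷ xs) = cong suc (count-true xs)

  count-false : ∀ xs → count (λ _ → false) xs ≡ 0
  count-false []       = refl
  count-false (_ ∷ xs) = count-false xs

  count-cong : ∀ {p q} xs → (∀ x → p x ≡ q x) → count p xs ≡ count q xs
  count-cong []       p≗q = refl
  count-cong {q = q} (x ∷ xs) p≗q rewrite p≗q x = cong (λ m → if q x then suc m else m) (count-cong xs p≗q)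

  count-mono : ∀ {p q} xs → (∀ x → T (p x) → T (q x)) → count p xs ≤ count q xs
  count-mono []                p⇒q = z≤n
  count-mono {p} {q} (x ∷ xs) p⇒q with p x | q x | p⇒q x
  ... | true  | true  | _   = s≤s (count-mono xs p⇒q)
  ... | true  | false | imp = ⊥-elim (imp _)
  ... | false | true  | _   = m≤n⇒m≤1+n (count-mono xs p⇒q)
  ... | false | false | _   = count-mono xs p⇒q

  count-mono-< : ∀ {p q x} xs → (∀ x → T (p x) → T (q x)) → x ∈ xs → ¬ T (p x) → T (q x) →
    count p xs < count q xs
  count-mono-< {p} {q} (x ∷ xs) p⇒q (here refl) ¬px qx with p x | q x
  ... | true  | _     = ⊥-elim (¬px _)
  ... | false | true  = s≤s (count-mono xs p⇒q)
  count-mono-< {p} {q} (y ∷ xs) p⇒q (there x∈) ¬px qx with p y | q y | p⇒q y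
  ... | true  | true  | _   = s≤s (count-mono-< xs p⇒q x∈ ¬px qx)
  ... | true  | false | imp = ⊥-elim (imp _)
  ... | false | true  | _   = s≤s (count-mono xs p⇒q)
  ... | false | false | _   = count-mono-< xs p⇒q x∈ ¬px qx

  length-filter≡count : ∀ p xs → length (filter (T? ∘ p) xs) ≡ count p xs
  length-filter≡count p []       = refl
  length-filter≡count p (x ∷ xs) with p x
  ... | true  = cong suc (length-filter≡count p xs)
  ... | false = length-filter≡count p xs

  count-∧-split : ∀ (p c : A → Bool) xs →
    count p xs ≡ count (λ x → p x ∧ c x) xs + count (λ x → p x ∧ not (c x)) xs
  count-∧-split p c []       = refl
  count-∧-split p c (x ∷ xs) with p x | c x
  ... | true  | true  = cong suc (count-∧-split p c xs)
  ... | true  | false = trans (cong suc (count-∧-split p c xs)) (sym (+-suc _ _))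
  ... | false | _     = count-∧-split p c xs

BinaryWord : ℕ → Set
BinaryWord n = Word n 2

count-allWords-suc : ∀ n (p : BinaryWord (suc n) → Bool) →
  count p (allWords (suc n) 2) ≡ count (p ∘ (0F ∷_)) (allWords n 2) + count (p ∘ (1F ∷_)) (allWords n 2)
count-allWords-suc n p = go (allWords n 2)
  where
  go : ∀ ws → count p (concatMap (λ w → map (_∷ w) (allFin 2)) ws) ≡
              count (p ∘ (0F ∷_)) ws + count (p ∘ (1F ∷_)) ws
  go []       = refl
  go (w ∷ ws) with p (0F ∷ w) | p (1F ∷ w)
  ... | true  | true  = cong suc (trans (cong suc (go ws)) (sym (+-suc _ _)))
  ... | true  | false = cong suc (go ws)
  ... | false | true  = trans (cong suc (go ws)) (sym (+-suc _ _))
  ... | false | false = go ws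

Key : Set
Key = Fin 2 × ℕ

infix 4 _≺_ _≺?_

data _≺_ : Key → Key → Set where
  label< : ∀ {x y}   → (0F , x) ≺ (1F , y)
  value< : ∀ {c x y} → x < y → (c , x) ≺ (c , y)

≺-irrefl : ∀ {p} → ¬ p ≺ p
≺-irrefl (value< x<x) = <-irrefl refl x<x

≺-asym : ∀ {p q} → p ≺ q → ¬ q ≺ p
≺-asym (value< x<y) (value< y<x) = <-asym x<y y<x

≺-trans : ∀ {p q r} → p ≺ q → q ≺ r → p ≺ r
≺-trans label<       (value< _)   = label<
≺-trans (value< _)   label<       = label<
≺-trans (value< x<y) (value< y<z) = value< (<-trans x<y y<z)

≺-compare-values : ∀ {c x y} → x ≢ y → (c , x) ≺ (c , y) ⊎ (c , y) ≺ (c , x)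
≺-compare-values {x = x} {y} x≢y with <-cmp x y
... | tri< x<y _ _ = inj₁ (value< x<y)
... | tri≈ _ x≡y _ = contradiction x≡y x≢y
... | tri> _ _ y<x = inj₂ (value< y<x)

≺-compare : ∀ c x d y → x ≢ y → (c , x) ≺ (d , y) ⊎ (d , y) ≺ (c , x)
≺-compare 0F x 1F y _   = inj₁ label<
≺-compare 1F x 0F y _   = inj₂ label<
≺-compare 0F x 0F y x≢y = ≺-compare-values x≢y
≺-compare 1F x 1F y x≢y = ≺-compare-values x≢y

≺-inversion : ∀ {c x d y} → (c , x) ≺ (d , y) → y < x → c ≡ 0F × d ≡ 1F
≺-inversion label<       _   = refl , refl
≺-inversion (value< x<y) y<x = contradiction y<x (<-asym x<y)

1F-≺ : ∀ {x q} → (1F , x) ≺ q → proj₁ q ≡ 1F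
1F-≺ (value< _) = refl

≺-0F : ∀ {p y} → p ≺ (0F , y) → proj₁ p ≡ 0F
≺-0F (value< _) = refl

≺-map-values : ∀ {c x d y x′ y′} → (x < y → x′ < y′) → (c , x) ≺ (d , y) → (c , x′) ≺ (d , y′)
≺-map-values f label<       = label<
≺-map-values f (value< x<y) = value< (f x<y)

value<⁻¹ : ∀ {c x y} → (c , x) ≺ (c , y) → x < y
value<⁻¹ (value< x<y) = x<y

_≺?_ : ∀ p q → Dec (p ≺ q)
(0F , x) ≺? (0F , y) = Dec.map′ value< value<⁻¹ (x <? y)
(0F , x) ≺? (1F , y) = yes label<
(1F , x) ≺? (0F , y) = no λ ()
(1F , x) ≺? (1F , y) = Dec.map′ value< value<⁻¹ (x <? y)

key : ∀ {n} → BinaryWord n → Fin n → Key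
key ℓ v = lookup ℓ v , toℕ v

infix 4 _≺[_]_ _≺[_]?_

_≺[_]_ : ∀ {n} → Fin n → BinaryWord n → Fin n → Set
v ≺[ ℓ ] w = key ℓ v ≺ key ℓ w

_≺[_]?_ : ∀ {n} (v : Fin n) ℓ w → Dec (v ≺[ ℓ ] w)
v ≺[ ℓ ]? w = key ℓ v ≺? key ℓ w

≺[]-compare : ∀ {n} (ℓ : BinaryWord n) {v w} → v ≢ w → v ≺[ ℓ ] w ⊎ w ≺[ ℓ ] v
≺[]-compare ℓ v≢w = ≺-compare _ _ _ _ (v≢w ∘ toℕ-injective)

≺[]-intro : ∀ {n} (ℓ : BinaryWord n) {v w c d} → lookup ℓ v ≡ c → lookup ℓ w ≡ d →
  (c , toℕ v) ≺ (d , toℕ w) → v ≺[ ℓ ] w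
≺[]-intro ℓ refl refl c,v≺d,w = c,v≺d,w

record Sorted {n} (ℓ : BinaryWord n) (π : Word n n) : Set where
  constructor sorted
  field mono : ∀ i j → i <ᶠ j → lookup π i ≺[ ℓ ] lookup π j
open Sorted

sorted⇒< : ∀ {n} {ℓ : BinaryWord n} {π} → Sorted ℓ π →
  ∀ i j → lookup π i ≺[ ℓ ] lookup π j → i <ᶠ j
sorted⇒< π-sorted i j πi≺πj with <ᶠ-cmp i j
... | tri< i<j _ _ = i<j
... | tri≈ _ refl _ = contradiction πi≺πj ≺-irrefl
... | tri> _ _ j<i = contradiction (mono π-sorted j i j<i) (≺-asym πi≺πj)

module _ {n} (π : Word n n) (π-perm : IsPerm π) where

  perm⁻¹ : Fin n → Fin n
  perm⁻¹ v = proj₁ (fin-injective⇒surjective (lookup π) π-perm v)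

  perm∘perm⁻¹ : ∀ v → lookup π (perm⁻¹ v) ≡ v
  perm∘perm⁻¹ v = proj₂ (fin-injective⇒surjective (lookup π) π-perm v)

  perm⁻¹∘perm : ∀ i → perm⁻¹ (lookup π i) ≡ i
  perm⁻¹∘perm i = π-perm _ _ (perm∘perm⁻¹ (lookup π i))

  sorted-transfer : ∀ {ℓ ℓ′} → Sorted ℓ π → Sorted ℓ′ π → ∀ v w → v ≺[ ℓ ] w → v ≺[ ℓ′ ] w
  sorted-transfer π-sorted π-sorted′ v w v≺w
    with perm⁻¹ v | perm∘perm⁻¹ v | perm⁻¹ w | perm∘perm⁻¹ w
  ... | i | refl | j | refl = mono π-sorted′ i j (sorted⇒< π-sorted i j v≺w)

sorted⇒perm⁻¹∘perm-increasing : ∀ {n} {ℓ : BinaryWord n} π ρ (ρ-perm : IsPerm ρ) →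
  Sorted ℓ π → Sorted ℓ ρ →
  StrictlyIncreasing (perm⁻¹ ρ ρ-perm ∘ lookup π)
sorted⇒perm⁻¹∘perm-increasing {ℓ = ℓ} π ρ ρ-perm π-sorted ρ-sorted i j i<j =
  sorted⇒< ρ-sorted _ _
    (subst₂ _≺[ ℓ ]_ (sym (perm∘perm⁻¹ ρ ρ-perm (lookup π i))) (sym (perm∘perm⁻¹ ρ ρ-perm (lookup π j)))
       (mono π-sorted i j i<j))

sorted-unique : ∀ {n} {ℓ : BinaryWord n} π ρ → IsPerm π → IsPerm ρ →
  Sorted ℓ π → Sorted ℓ ρ → π ≡ ρ
sorted-unique π ρ π-perm ρ-perm π-sorted ρ-sorted = lookup-ext π ρ πi≡ρi
  where
  h≗id : ∀ i → perm⁻¹ ρ ρ-perm (lookup π i) ≡ i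
  h≗id = increasing-section⇒id _ _
    (sorted⇒perm⁻¹∘perm-increasing π ρ ρ-perm π-sorted ρ-sorted)
    (sorted⇒perm⁻¹∘perm-increasing ρ π π-perm ρ-sorted π-sorted)
    (λ i → trans (cong (perm⁻¹ π π-perm) (perm∘perm⁻¹ ρ ρ-perm (lookup π i)))
                 (perm⁻¹∘perm π π-perm i))
  πi≡ρi : ∀ i → lookup π i ≡ lookup ρ i
  πi≡ρi i = trans (sym (perm∘perm⁻¹ ρ ρ-perm (lookup π i))) (cong (lookup ρ) (h≗id i))

module SortBy {n} (ℓ : BinaryWord n) where

  rank : Fin n → ℕ
  rank v = count (λ w → ⌊ w ≺[ ℓ ]? v ⌋) (allFin n)

  rank<n : ∀ v → rank v < n
  rank<n v = subst (rank v <_) (trans (count-true (allFin n)) (length-tabulate (λ i → i)))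
    (count-mono-< (allFin n) (λ _ _ → _) (∈-allFin v) (≺-irrefl ∘ toWitness {a? = v ≺[ ℓ ]? v}) _)

  rank-mono : ∀ {v w} → v ≺[ ℓ ] w → rank v < rank w
  rank-mono {v} {w} v≺w = count-mono-< (allFin n)
    (λ x x≺v → fromWitness {a? = x ≺[ ℓ ]? w} (≺-trans (toWitness {a? = x ≺[ ℓ ]? v} x≺v) v≺w))
    (∈-allFin v) (≺-irrefl ∘ toWitness {a? = v ≺[ ℓ ]? v}) (fromWitness {a? = v ≺[ ℓ ]? w} v≺w)

  rank-injective : ∀ {v w} → rank v ≡ rank w → v ≡ w
  rank-injective {v} {w} same-rank with v ≟ᶠ w
  ... | yes v≡w = v≡w
  ... | no v≢w with ≺[]-compare ℓ v≢w
  ...   | inj₁ v≺w = contradiction same-rank (<⇒≢ (rank-mono v≺w))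
  ...   | inj₂ w≺v = contradiction (sym same-rank) (<⇒≢ (rank-mono w≺v))

  rankᶠ : Fin n → Fin n
  rankᶠ v = fromℕ< (rank<n v)

  rankᶠ-injective : ∀ v w → rankᶠ v ≡ rankᶠ w → v ≡ w
  rankᶠ-injective v w eq = rank-injective
    (trans (sym (toℕ-fromℕ< (rank<n v))) (trans (cong toℕ eq) (toℕ-fromℕ< (rank<n w))))

  unrank : Fin n → Fin n
  unrank i = proj₁ (fin-injective⇒surjective rankᶠ rankᶠ-injective i)

  sortBy : Word n n
  sortBy = tabulate unrank

  rank-sortBy : ∀ i → rank (lookup sortBy i) ≡ toℕ i
  rank-sortBy i = begin
    rank (lookup sortBy i)     ≡⟨ cong rank (lookup∘tabulate unrank i) ⟩
    rank (unrank i)            ≡⟨ toℕ-fromℕ< (rank<n (unrank i)) ⟨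
    toℕ (rankᶠ (unrank i))     ≡⟨ cong toℕ (proj₂ (fin-injective⇒surjective rankᶠ rankᶠ-injective i)) ⟩
    toℕ i                      ∎
    where open ≡-Reasoning

  sortBy-perm : IsPerm sortBy
  sortBy-perm i j eq = toℕ-injective (trans (sym (rank-sortBy i)) (trans (cong rank eq) (rank-sortBy j)))

  sortBy-sorted : Sorted ℓ sortBy
  sortBy-sorted = sorted λ i j i<j →
    [ (λ πi≺πj → πi≺πj)
    , (λ πj≺πi → contradiction (subst₂ _<_ (rank-sortBy j) (rank-sortBy i) (rank-mono πj≺πi))
                               (<-asym i<j)) ]′
    (≺[]-compare ℓ (λ eq → <-irrefl (cong toℕ (sortBy-perm i j eq)) i<j))

open SortBy using (sortBy; sortBy-perm; sortBy-sorted)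

module _ {n} (π : Word n n) where

  descents : List (Fin n)
  descents = filter (isDescentAt? π) (allFin n)

  ∈-descents⁺ : ∀ {p} → IsDescentAt π p → p ∈ descents
  ∈-descents⁺ {p} = ∈-filter⁺ (isDescentAt? π) (∈-allFin p)

  ∈-descents⁻ : ∀ {p} → p ∈ descents → IsDescentAt π p
  ∈-descents⁻ = proj₂ ∘ ∈-filter⁻ (isDescentAt? π) {xs = allFin n}

  grassmannian-descent-unique : IsGrassmannian π → ∀ {p q} → IsDescentAt π p → IsDescentAt π q → p ≡ q
  grassmannian-descent-unique grassmannian p-desc q-desc =
    members-equal grassmannian (∈-descents⁺ p-desc) (∈-descents⁺ q-desc)

  descent-unique⇒grassmannian : (∀ {p q} → IsDescentAt π p → IsDescentAt π q → p ≡ q) → IsGrassmannian π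
  descent-unique⇒grassmannian unique = members-equal⇒length≤1 (filter⁺ (isDescentAt? π) (allFin⁺ n))
    (λ p∈ q∈ → unique (∈-descents⁻ p∈) (∈-descents⁻ q∈))

  des≡1⇒descent : des π ≡ 1 → ∃ (IsDescentAt π)
  des≡1⇒descent des≡1 =
    let p , p∈ = nonempty⇒∃∈ (≤-reflexive (sym des≡1)) in p , ∈-descents⁻ p∈

module _ {n} {ℓ : BinaryWord n} {π : Word n n} (π-sorted : Sorted ℓ π) where

  private
    label : Fin n → Fin 2
    label i = lookup ℓ (lookup π i)

  sorted-label-1F : ∀ {i j} → i ≤ᶠ j → label i ≡ 1F → label j ≡ 1F
  sorted-label-1F {i} {j} i≤j i↦1 with m≤n⇒m<n∨m≡n i≤j
  ... | inj₁ i<j = 1F-≺ (subst (λ c → (c , _) ≺ _) i↦1 (mono π-sorted i j i<j))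
  ... | inj₂ i≡j = subst (λ x → label x ≡ 1F) (toℕ-injective i≡j) i↦1

  descent-labels : ∀ {p} → ((q , _ , _) : IsDescentAt π p) → label p ≡ 0F × label q ≡ 1F
  descent-labels {p} (q , q≡1+p , πq<πp) = ≺-inversion (mono π-sorted p q (≤-reflexive (sym q≡1+p))) πq<πp

  sorted⇒grassmannian : IsGrassmannian π
  sorted⇒grassmannian = descent-unique⇒grassmannian π unique
    where
    no-later-descent : ∀ {p p′} → p <ᶠ p′ → IsDescentAt π p → ¬ IsDescentAt π p′
    no-later-descent p<p′ p-desc@(q , q≡1+p , _) p′-desc =
      0≢1+n (trans (sym (proj₁ (descent-labels p′-desc)))
                   (sorted-label-1F (subst (_≤ _) (sym q≡1+p) p<p′) (proj₂ (descent-labels p-desc))))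
    unique : ∀ {p p′} → IsDescentAt π p → IsDescentAt π p′ → p ≡ p′
    unique {p} {p′} p-desc p′-desc with <ᶠ-cmp p p′
    ... | tri< p<p′ _ _ = contradiction p′-desc (no-later-descent p<p′ p-desc)
    ... | tri≈ _ p≡p′ _ = p≡p′
    ... | tri> _ _ p′<p = contradiction p-desc (no-later-descent p′<p p′-desc)

module _ {n} (π : Word n n) (π-perm : IsPerm π) where

  ascent : ∀ {p q} → toℕ q ≡ suc (toℕ p) → ¬ IsDescentAt π p → lookup π p <ᶠ lookup π q
  ascent {p} {q} q≡1+p no-descent = ≤∧≢⇒< (≮⇒≥ λ πq<πp → no-descent (q , q≡1+p , πq<πp)) πp≢πq
    where
    πp≢πq : toℕ (lookup π p) ≢ toℕ (lookup π q)
    πp≢πq eq = 1+n≢n (trans (sym q≡1+p) (cong toℕ (sym (π-perm p q (toℕ-injective eq)))))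

  ascending-run : ∀ {i j} → i <ᶠ j → (∀ p → i ≤ᶠ p → p <ᶠ j → ¬ IsDescentAt π p) →
    lookup π i <ᶠ lookup π j
  ascending-run {i} {j} i<j = run (toℕ j ∸ suc (toℕ i)) j (sym (trans (sym (+-suc _ _)) (m∸n+n≡m i<j)))
    where
    run : ∀ m j → toℕ j ≡ suc (m + toℕ i) → (∀ p → i ≤ᶠ p → p <ᶠ j → ¬ IsDescentAt π p) →
      lookup π i <ᶠ lookup π j
    run zero    j j≡1+i no-descent = ascent j≡1+i (no-descent i ≤-refl (≤-reflexive (sym j≡1+i)))
    run (suc m) j j≡2+m+i no-descent =
      <-trans (run m j′ j′≡1+m+i (λ p i≤p p<j′ → no-descent p i≤p (<-trans p<j′ j′<j)))
              (ascent j≡1+j′ (no-descent j′ i≤j′ j′<j))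
      where
      j′ : Fin n
      j′ = fromℕ< (<-trans (n<1+n _) (subst (_< n) j≡2+m+i (toℕ<n j)))
      j′≡1+m+i : toℕ j′ ≡ suc (m + toℕ i)
      j′≡1+m+i = toℕ-fromℕ< _
      j≡1+j′ : toℕ j ≡ suc (toℕ j′)
      j≡1+j′ = trans j≡2+m+i (cong suc (sym j′≡1+m+i))
      j′<j : j′ <ᶠ j
      j′<j = ≤-reflexive (sym j≡1+j′)
      i≤j′ : i ≤ᶠ j′
      i≤j′ = subst (toℕ i ≤_) (sym j′≡1+m+i) (≤-trans (m≤n+m (toℕ i) m) (n≤1+n _))

  side : Fin n → Fin n → Fin 2
  side d i = choose (toℕ i ≤? toℕ d)
    where
    choose : ∀ {A : Set} → Dec A → Fin 2
    choose (yes _) = 0F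
    choose (no _)  = 1F

  side-≤ : ∀ {d i} → i ≤ᶠ d → side d i ≡ 0F
  side-≤ {d} {i} i≤d with toℕ i ≤? toℕ d
  ... | yes _   = refl
  ... | no  i≰d = contradiction i≤d i≰d

  side-> : ∀ {d i} → d <ᶠ i → side d i ≡ 1F
  side-> {d} {i} d<i with toℕ i ≤? toℕ d
  ... | yes i≤d = contradiction i≤d (<⇒≱ d<i)
  ... | no  _   = refl

  splitAt : Fin n → BinaryWord n
  splitAt d = tabulate (side d ∘ perm⁻¹ π π-perm)

  splitAt-label : ∀ d i → lookup (splitAt d) (lookup π i) ≡ side d i
  splitAt-label d i = trans (lookup∘tabulate _ (lookup π i)) (cong (side d) (perm⁻¹∘perm π π-perm i))

  sorted-splitAt : ∀ d → (∀ {p} → IsDescentAt π p → p ≡ d) → Sorted (splitAt d) π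
  sorted-splitAt d only-d = sorted mono′
    where
    label-≤ : ∀ {i} → i ≤ᶠ d → lookup (splitAt d) (lookup π i) ≡ 0F
    label-≤ i≤d = trans (splitAt-label d _) (side-≤ i≤d)
    label-> : ∀ {i} → d <ᶠ i → lookup (splitAt d) (lookup π i) ≡ 1F
    label-> d<i = trans (splitAt-label d _) (side-> d<i)
    mono′ : ∀ i j → i <ᶠ j → lookup π i ≺[ splitAt d ] lookup π j
    mono′ i j i<j with toℕ j ≤? toℕ d
    ... | yes j≤d = ≺[]-intro (splitAt d) (label-≤ (≤-trans (<⇒≤ i<j) j≤d)) (label-≤ j≤d)
          (value< (ascending-run i<j λ p _ p<j p-desc →
             <⇒≱ p<j (subst (λ x → toℕ j ≤ toℕ x) (sym (only-d p-desc)) j≤d)))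
    ... | no j≰d with toℕ i ≤? toℕ d
    ...   | yes i≤d = ≺[]-intro (splitAt d) (label-≤ i≤d) (label-> (≰⇒> j≰d)) label<
    ...   | no  i≰d = ≺[]-intro (splitAt d) (label-> (≰⇒> i≰d)) (label-> (≰⇒> j≰d))
          (value< (ascending-run i<j λ p i≤p _ p-desc →
             i≰d (subst (λ x → toℕ i ≤ toℕ x) (only-d p-desc) i≤p)))

grassmannian⇒sorted : ∀ {n} (π : Word n n) → IsPerm π → IsGrassmannian π → ∃ λ ℓ → Sorted ℓ π
grassmannian⇒sorted {zero}  π _      _            = [] , sorted λ ()
grassmannian⇒sorted {suc _} π π-perm grassmannian with any? (isDescentAt? π)
... | yes (d , d-desc) =
  splitAt π π-perm d ,
  sorted-splitAt π π-perm d (λ p-desc → grassmannian-descent-unique π grassmannian p-desc d-desc)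
... | no none = splitAt π π-perm zero , sorted-splitAt π π-perm zero (λ p-desc → contradiction (_ , p-desc) none)

Unsorted : ∀ {n} → BinaryWord n → Set
Unsorted {n} ℓ = ∃ λ (s : Fin n) → ∃ λ (t : Fin n) → s <ᶠ t × lookup ℓ s ≡ 1F × lookup ℓ t ≡ 0F

-- Every labelling 0…01…1 sorts [n] into the identity; 0…0 is the one kept.
Canonical : ∀ {n} → BinaryWord n → Set
Canonical {n} ℓ = Unsorted ℓ ⊎ ℓ ≡ replicate n 0F

containsZeroᵇ : ∀ {n} → BinaryWord n → Bool
containsZeroᵇ []       = false
containsZeroᵇ (0F ∷ ℓ) = true
containsZeroᵇ (1F ∷ ℓ) = containsZeroᵇ ℓ

unsortedᵇ : ∀ {n} → BinaryWord n → Bool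
unsortedᵇ []       = false
unsortedᵇ (0F ∷ ℓ) = unsortedᵇ ℓ
unsortedᵇ (1F ∷ ℓ) = containsZeroᵇ ℓ

zerosᵇ : ∀ {n} → BinaryWord n → Bool
zerosᵇ []       = true
zerosᵇ (0F ∷ ℓ) = zerosᵇ ℓ
zerosᵇ (1F ∷ ℓ) = false

canonicalᵇ : ∀ {n} → BinaryWord n → Bool
canonicalᵇ ℓ = unsortedᵇ ℓ ∨ zerosᵇ ℓ

containsZeroᵇ-sound : ∀ {n} (ℓ : BinaryWord n) → T (containsZeroᵇ ℓ) → ∃ λ t → lookup ℓ t ≡ 0F
containsZeroᵇ-sound (0F ∷ ℓ) _ = zero , refl
containsZeroᵇ-sound (1F ∷ ℓ) h = let t , ℓt = containsZeroᵇ-sound ℓ h in suc t , ℓt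

containsZeroᵇ-complete : ∀ {n} (ℓ : BinaryWord n) t → lookup ℓ t ≡ 0F → T (containsZeroᵇ ℓ)
containsZeroᵇ-complete (0F ∷ ℓ) t       _  = _
containsZeroᵇ-complete (1F ∷ ℓ) (suc t) ℓt = containsZeroᵇ-complete ℓ t ℓt

unsortedᵇ-sound : ∀ {n} (ℓ : BinaryWord n) → T (unsortedᵇ ℓ) → Unsorted ℓ
unsortedᵇ-sound (0F ∷ ℓ) h =
  let s , t , s<t , ℓs , ℓt = unsortedᵇ-sound ℓ h in suc s , suc t , s≤s s<t , ℓs , ℓt
unsortedᵇ-sound (1F ∷ ℓ) h = let t , ℓt = containsZeroᵇ-sound ℓ h in zero , suc t , s≤s z≤n , refl , ℓt

unsortedᵇ-complete : ∀ {n} (ℓ : BinaryWord n) → Unsorted ℓ → T (unsortedᵇ ℓ)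
unsortedᵇ-complete (0F ∷ ℓ) (suc s , suc t , s≤s s<t , ℓs , ℓt) =
  unsortedᵇ-complete ℓ (s , t , s<t , ℓs , ℓt)
unsortedᵇ-complete (1F ∷ ℓ) (_     , suc t , _       , _  , ℓt) = containsZeroᵇ-complete ℓ t ℓt

unsorted? : ∀ {n} (ℓ : BinaryWord n) → Dec (Unsorted ℓ)
unsorted? ℓ = Dec.map′ (unsortedᵇ-sound ℓ) (unsortedᵇ-complete ℓ) (T? (unsortedᵇ ℓ))

zerosᵇ-sound : ∀ {n} (ℓ : BinaryWord n) → T (zerosᵇ ℓ) → ℓ ≡ replicate n 0F
zerosᵇ-sound []       _ = refl
zerosᵇ-sound (0F ∷ ℓ) h = cong (0F ∷_) (zerosᵇ-sound ℓ h)
zerosᵇ-sound (1F ∷ ℓ) ()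

zerosᵇ-replicate : ∀ n → T (zerosᵇ (replicate n 0F))
zerosᵇ-replicate zero    = _
zerosᵇ-replicate (suc n) = zerosᵇ-replicate n

canonicalᵇ-sound : ∀ {n} (ℓ : BinaryWord n) → T (canonicalᵇ ℓ) → Canonical ℓ
canonicalᵇ-sound ℓ h with Equivalence.to (T-∨ {unsortedᵇ ℓ}) h
... | inj₁ unsorted = inj₁ (unsortedᵇ-sound ℓ unsorted)
... | inj₂ zeros    = inj₂ (zerosᵇ-sound ℓ zeros)

canonicalᵇ-complete : ∀ {n} (ℓ : BinaryWord n) → Canonical ℓ → T (canonicalᵇ ℓ)
canonicalᵇ-complete     ℓ (inj₁ unsorted) =
  Equivalence.from (T-∨ {unsortedᵇ ℓ}) (inj₁ (unsortedᵇ-complete ℓ unsorted))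
canonicalᵇ-complete {n} ℓ (inj₂ refl)     =
  Equivalence.from (T-∨ {unsortedᵇ ℓ}) (inj₂ (zerosᵇ-replicate n))

count-¬containsZero : ∀ n → count (not ∘ containsZeroᵇ) (allWords n 2) ≡ 1
count-¬containsZero zero    = refl
count-¬containsZero (suc n) =
  trans (count-allWords-suc n _) (cong₂ _+_ (count-false (allWords n 2)) (count-¬containsZero n))

count-noncanonical : ∀ n → count (not ∘ canonicalᵇ) (allWords n 2) ≡ n
count-noncanonical zero    = refl
count-noncanonical (suc n) = begin
  count (not ∘ canonicalᵇ) (allWords (suc n) 2)
    ≡⟨ count-allWords-suc n _ ⟩
  count (not ∘ canonicalᵇ) (allWords n 2) + count (λ ℓ → not (containsZeroᵇ ℓ ∨ false)) (allWords n 2)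
    ≡⟨ cong₂ _+_ (count-noncanonical n)
         (trans (count-cong (allWords n 2) (λ ℓ → cong not (∨-identityʳ _))) (count-¬containsZero n)) ⟩
  n + 1
    ≡⟨ +-comm n 1 ⟩
  suc n ∎
  where open ≡-Reasoning

descent⇒unsorted : ∀ {n} {ℓ : BinaryWord n} {π} → Sorted ℓ π → ∀ {p} → IsDescentAt π p → Unsorted ℓ
descent⇒unsorted {π = π} π-sorted {p} desc@(q , _ , πq<πp) =
  let πp↦0 , πq↦1 = descent-labels π-sorted desc in lookup π q , lookup π p , πq<πp , πq↦1 , πp↦0

¬unsorted⇒≺-values : ∀ {n} (ℓ : BinaryWord n) → ¬ Unsorted ℓ → ∀ {v w} → v ≺[ ℓ ] w → v <ᶠ w
¬unsorted⇒≺-values ℓ ¬unsorted {v} {w} v≺w with <ᶠ-cmp v w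
... | tri< v<w _ _  = v<w
... | tri≈ _ refl _ = contradiction v≺w ≺-irrefl
... | tri> _ _ w<v  = let v↦0 , w↦1 = ≺-inversion v≺w w<v in contradiction (w , v , w<v , w↦1 , v↦0) ¬unsorted

canonicalise : ∀ {n} {ℓ : BinaryWord n} {π} → Sorted ℓ π → ∃ λ ℓ′ → Sorted ℓ′ π × Canonical ℓ′
canonicalise {n} {ℓ} {π} π-sorted with unsorted? ℓ
... | yes unsorted = ℓ , π-sorted , inj₁ unsorted
... | no ¬unsorted = replicate n 0F , sorted by-value , inj₂ refl
  where
  by-value : ∀ i j → i <ᶠ j → lookup π i ≺[ replicate n 0F ] lookup π j
  by-value i j i<j = ≺[]-intro (replicate n 0F) (lookup-replicate (lookup π i) 0F) (lookup-replicate (lookup π j) 0F)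
    (value< (¬unsorted⇒≺-values ℓ ¬unsorted (mono π-sorted i j i<j)))

unsorted-determined : ∀ {n} (ℓ ℓ′ : BinaryWord n) → Unsorted ℓ →
  (∀ v w → v ≺[ ℓ ] w → v ≺[ ℓ′ ] w) → ℓ ≡ ℓ′
unsorted-determined ℓ ℓ′ (s , t , s<t , ℓs , ℓt) ≺⊆≺′ = lookup-ext ℓ ℓ′ same
  where
  ℓ′t,ℓ′s : lookup ℓ′ t ≡ 0F × lookup ℓ′ s ≡ 1F
  ℓ′t,ℓ′s = ≺-inversion (≺⊆≺′ t s (≺[]-intro ℓ ℓt ℓs label<)) s<t
  same : ∀ x → lookup ℓ x ≡ lookup ℓ′ x
  same x with lookup ℓ x in ℓx
  ... | 0F with <ᶠ-cmp x s
  ...   | tri< x<s _ _  = sym (≺-0F (subst (λ c → _ ≺ (c , _)) (proj₁ ℓ′t,ℓ′s)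
                            (≺⊆≺′ x t (≺[]-intro ℓ ℓx ℓt (value< (<-trans x<s s<t))))))
  ...   | tri≈ _ refl _ = contradiction (trans (sym ℓx) ℓs) 0≢1+n
  ...   | tri> _ _ s<x  = sym (proj₁ (≺-inversion (≺⊆≺′ x s (≺[]-intro ℓ ℓx ℓs label<)) s<x))
  same x | 1F with <ᶠ-cmp x t
  ...   | tri< x<t _ _  = sym (proj₂ (≺-inversion (≺⊆≺′ t x (≺[]-intro ℓ ℓt ℓx label<)) x<t))
  ...   | tri≈ _ refl _ = contradiction (trans (sym ℓt) ℓx) 0≢1+n
  ...   | tri> _ _ t<x  = sym (1F-≺ (subst (λ c → (c , _) ≺ _) (proj₂ ℓ′t,ℓ′s)
                            (≺⊆≺′ s x (≺[]-intro ℓ ℓs ℓx (value< (<-trans s<t t<x))))))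

sortBy-injective : ∀ {n} {ℓ ℓ′ : BinaryWord n} → Canonical ℓ → Canonical ℓ′ →
  sortBy ℓ ≡ sortBy ℓ′ → ℓ ≡ ℓ′
sortBy-injective {ℓ = ℓ} {ℓ′} (inj₁ unsorted) _ same = unsorted-determined ℓ ℓ′ unsorted
  (sorted-transfer (sortBy ℓ) (sortBy-perm ℓ) (sortBy-sorted ℓ)
    (subst (Sorted ℓ′) (sym same) (sortBy-sorted ℓ′)))
sortBy-injective {ℓ = ℓ} {ℓ′} (inj₂ _) (inj₁ unsorted′) same = sym (unsorted-determined ℓ′ ℓ unsorted′
  (sorted-transfer (sortBy ℓ′) (sortBy-perm ℓ′) (sortBy-sorted ℓ′)
    (subst (Sorted ℓ) same (sortBy-sorted ℓ))))
sortBy-injective (inj₂ refl) (inj₂ refl) _ = refl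

module _ {A : Set} where

  infix 4 _⊑_

  record _⊑_ {k n} (u : Vec A k) (w : Vec A n) : Set where
    constructor embedding
    field
      index        : Fin k → Fin n
      index-mono   : StrictlyIncreasing index
      index-lookup : ∀ s → lookup w (index s) ≡ lookup u s

  []⊑ : ∀ {n} (w : Vec A n) → [] ⊑ w
  []⊑ w = embedding (λ ()) (λ ()) (λ ())

  ⊑-skip : ∀ {k n c} {u : Vec A k} {w : Vec A n} → u ⊑ w → u ⊑ c ∷ w
  ⊑-skip (embedding e e-mono e-lookup) = embedding (suc ∘ e) (λ i j i<j → s≤s (e-mono i j i<j)) e-lookup

  ⊑-keep : ∀ {k n x} {u : Vec A k} {w : Vec A n} → u ⊑ w → x ∷ u ⊑ x ∷ w
  ⊑-keep {k} {n} {x} {u} {w} (embedding e e-mono e-lookup) = embedding e′ e′-mono e′-lookup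
    where
    e′ : Fin (suc k) → Fin (suc n)
    e′ zero    = zero
    e′ (suc s) = suc (e s)
    e′-mono : StrictlyIncreasing e′
    e′-mono zero    (suc j) _         = s≤s z≤n
    e′-mono (suc i) (suc j) (s≤s i<j) = s≤s (e-mono i j i<j)
    e′-lookup : ∀ s → lookup (x ∷ w) (e′ s) ≡ lookup (x ∷ u) s
    e′-lookup zero    = refl
    e′-lookup (suc s) = e-lookup s

  ⊑-unskip : ∀ {k n c} {u : Vec A k} {w : Vec A n} (emb : u ⊑ c ∷ w) →
    (∀ s → _⊑_.index emb s ≢ zero) → u ⊑ w
  ⊑-unskip {k} {n} {c} {u} {w} (embedding e e-mono e-lookup) e≢0 = embedding e′ e′-mono e′-lookup
    where
    unsuc : (i : Fin (suc n)) → i ≢ zero → ∃ λ j → suc j ≡ i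
    unsuc zero    i≢0 = contradiction refl i≢0
    unsuc (suc j) _   = j , refl
    e′ : Fin k → Fin n
    e′ s = proj₁ (unsuc (e s) (e≢0 s))
    suc-e′ : ∀ s → suc (e′ s) ≡ e s
    suc-e′ s = proj₂ (unsuc (e s) (e≢0 s))
    e′-mono : StrictlyIncreasing e′
    e′-mono i j i<j = ≤-pred (subst₂ _<ᶠ_ (sym (suc-e′ i)) (sym (suc-e′ j)) (e-mono i j i<j))
    e′-lookup : ∀ s → lookup w (e′ s) ≡ lookup u s
    e′-lookup s = trans (cong (lookup (c ∷ w)) (suc-e′ s)) (e-lookup s)

  private
    index-suc≢0 : ∀ {k n} {u : Vec A (suc k)} {w : Vec A (suc n)} (emb : u ⊑ w) s → _⊑_.index emb (suc s) ≢ zero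
    index-suc≢0 (embedding e e-mono _) s e[1+s]≡0 =
      <⇒≱ (e-mono zero (suc s) (s≤s z≤n)) (subst (λ i → toℕ i ≤ toℕ (e zero)) (sym e[1+s]≡0) z≤n)

  ∷⊑∷⁻ : ∀ {k n x c} {u : Vec A k} {w : Vec A n} → x ∷ u ⊑ c ∷ w → u ⊑ w
  ∷⊑∷⁻ emb@(embedding e e-mono e-lookup) =
    ⊑-unskip (embedding (e ∘ suc) (λ i j i<j → e-mono (suc i) (suc j) (s≤s i<j)) (e-lookup ∘ suc))
             (index-suc≢0 emb)

  ∷⊑∷⁻-≢ : ∀ {k n x c} {u : Vec A k} {w : Vec A n} → x ≢ c → x ∷ u ⊑ c ∷ w → x ∷ u ⊑ w
  ∷⊑∷⁻-≢ {c = c} {w = w} x≢c emb@(embedding e _ e-lookup) = ⊑-unskip emb e≢0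
    where
    e≢0 : ∀ s → e s ≢ zero
    e≢0 zero    e0≡0 = x≢c (trans (sym (e-lookup zero)) (cong (lookup (c ∷ w)) e0≡0))
    e≢0 (suc s) = index-suc≢0 emb s

module _ {A : Set} (_≟_ : DecidableEquality A) where

  subsequenceᵇ : ∀ {k n} → Vec A k → Vec A n → Bool
  subsequenceᵇ []      _       = true
  subsequenceᵇ (x ∷ u) []      = false
  subsequenceᵇ (x ∷ u) (c ∷ w) = if does (x ≟ c) then subsequenceᵇ u w else subsequenceᵇ (x ∷ u) w

  ⊑⇒subsequenceᵇ : ∀ {k n} (u : Vec A k) (w : Vec A n) → u ⊑ w → T (subsequenceᵇ u w)
  ⊑⇒subsequenceᵇ []      _       _   = _
  ⊑⇒subsequenceᵇ (x ∷ u) []      emb with () ← _⊑_.index emb zero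
  ⊑⇒subsequenceᵇ (x ∷ u) (c ∷ w) u⊑w with x ≟ c
  ... | yes _   = ⊑⇒subsequenceᵇ u w (∷⊑∷⁻ u⊑w)
  ... | no  x≢c = ⊑⇒subsequenceᵇ (x ∷ u) w (∷⊑∷⁻-≢ x≢c u⊑w)

  subsequenceᵇ⇒⊑ : ∀ {k n} (u : Vec A k) (w : Vec A n) → T (subsequenceᵇ u w) → u ⊑ w
  subsequenceᵇ⇒⊑ []      w       _ = []⊑ w
  subsequenceᵇ⇒⊑ (x ∷ u) (c ∷ w) h with x ≟ c
  ... | yes refl = ⊑-keep (subsequenceᵇ⇒⊑ u w h)
  ... | no  _    = ⊑-skip (subsequenceᵇ⇒⊑ (x ∷ u) w h)

T-not⇒¬T : ∀ {b} → T (not b) → ¬ T b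
T-not⇒¬T {true} ()

¬T⇒T-not : ∀ {b} → ¬ T b → T (not b)
¬T⇒T-not {false} _  = _
¬T⇒T-not {true}  ¬t = ¬t _

module _ {k n} {σ : Word k k} {u : BinaryWord k} {π : Word n n} {ℓ : BinaryWord n}
         (σ-perm : IsPerm σ) (σ-sorted : Sorted u σ) (π-perm : IsPerm π) (π-sorted : Sorted ℓ π) where

  contains⇒⊑ : Unsorted u → Contains σ π → u ⊑ ℓ
  contains⇒⊑ u-unsorted (ι , ι-mono , ι-iso) = embedding E E-mono E-lookup
    where
    σσ⁻¹ : ∀ s → lookup σ (perm⁻¹ σ σ-perm s) ≡ s
    σσ⁻¹ = perm∘perm⁻¹ σ σ-perm
    E : Fin k → Fin n
    E s = lookup π (lookup ι (perm⁻¹ σ σ-perm s))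
    E-mono : StrictlyIncreasing E
    E-mono s t s<t = proj₂ (ι-iso _ _) (subst₂ _<ᶠ_ (sym (σσ⁻¹ s)) (sym (σσ⁻¹ t)) s<t)
    u′ : BinaryWord k
    u′ = tabulate (lookup ℓ ∘ E)
    ≺u⊆≺u′ : ∀ s t → s ≺[ u ] t → s ≺[ u′ ] t
    ≺u⊆≺u′ s t s≺t = ≺[]-intro u′ (lookup∘tabulate _ s) (lookup∘tabulate _ t)
      (≺-map-values (increasing⇒reflects E E-mono s t)
        (mono π-sorted _ _ (ι-mono _ _ (sorted⇒< σ-sorted _ _
          (subst₂ _≺[ u ]_ (sym (σσ⁻¹ s)) (sym (σσ⁻¹ t)) s≺t)))))
    E-lookup : ∀ s → lookup ℓ (E s) ≡ lookup u s
    E-lookup s = trans (sym (lookup∘tabulate _ s))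
                       (cong (λ v → lookup v s) (sym (unsorted-determined u u′ u-unsorted ≺u⊆≺u′)))

  ⊑⇒contains : u ⊑ ℓ → Contains σ π
  ⊑⇒contains (embedding e e-mono e-lookup) = ι , ι-mono , ι-iso
    where
    ι : Word k n
    ι = tabulate (λ a → perm⁻¹ π π-perm (e (lookup σ a)))
    πι : ∀ a → lookup π (lookup ι a) ≡ e (lookup σ a)
    πι a = trans (cong (lookup π) (lookup∘tabulate _ a)) (perm∘perm⁻¹ π π-perm _)
    ι-mono : ∀ a b → a <ᶠ b → lookup ι a <ᶠ lookup ι b
    ι-mono a b a<b = sorted⇒< π-sorted _ _ (subst₂ _≺[ ℓ ]_ (sym (πι a)) (sym (πι b))
      (≺[]-intro ℓ (e-lookup _) (e-lookup _) (≺-map-values (e-mono _ _) (mono σ-sorted a b a<b))))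
    ι-iso : ∀ a b → (lookup π (lookup ι a) <ᶠ lookup π (lookup ι b) → lookup σ a <ᶠ lookup σ b) ×
                    (lookup σ a <ᶠ lookup σ b → lookup π (lookup ι a) <ᶠ lookup π (lookup ι b))
    ι-iso a b = (λ πιa<πιb → increasing⇒reflects e e-mono _ _ (subst₂ _<ᶠ_ (πι a) (πι b) πιa<πιb))
              , (λ σa<σb → subst₂ _<ᶠ_ (sym (πι a)) (sym (πι b)) (e-mono _ _ σa<σb))

⊑-unsorted : ∀ {k n} {u : BinaryWord k} {ℓ : BinaryWord n} → Unsorted u → u ⊑ ℓ → Unsorted ℓ
⊑-unsorted (s , t , s<t , us , ut) (embedding e e-mono e-lookup) =
  e s , e t , e-mono s t s<t , trans (e-lookup s) us , trans (e-lookup t) ut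

-- sumBelow (suc k) f unfolds definitionally to f 0 + sumBelow k (f ∘ suc), and n C 0 to 1;
-- the calculations below start from these unfolded forms.
sumBelow : ℕ → (ℕ → ℕ) → ℕ
sumBelow k f = sum (applyUpTo f k)

sumBelow-cong : ∀ k {f g} → (∀ i → f i ≡ g i) → sumBelow k f ≡ sumBelow k g
sumBelow-cong zero    f≗g = refl
sumBelow-cong (suc k) f≗g = cong₂ _+_ (f≗g 0) (sumBelow-cong k (f≗g ∘ suc))

sumBelow-+ : ∀ k f g → sumBelow k (λ i → f i + g i) ≡ sumBelow k f + sumBelow k g
sumBelow-+ zero    f g = refl
sumBelow-+ (suc k) f g =
  trans (cong (f 0 + g 0 +_) (sumBelow-+ k (f ∘ suc) (g ∘ suc))) (interchange +-commutativeSemigroup (f 0) (g 0) _ _)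

sumBelow-zeros : ∀ k → sumBelow k (λ _ → 0) ≡ 0
sumBelow-zeros zero    = refl
sumBelow-zeros (suc k) = sumBelow-zeros k

sumFromTo≡sumBelow : ∀ a b f → sumFromTo a b f ≡ sumBelow (suc b ∸ a) (λ i → f (a + i))
sumFromTo≡sumBelow a b f = cong sum (map-applyUpTo (λ i → i) (λ i → f (a + i)) (suc b ∸ a))

pascal-sumBelow : ∀ n k → sumBelow k (n C_) + sumBelow (suc k) (n C_) ≡ sumBelow (suc k) (suc n C_)
pascal-sumBelow n k = begin
  sumBelow k (n C_) + suc (sumBelow k (λ i → n C suc i))  ≡⟨ +-suc _ _ ⟩
  suc (sumBelow k (n C_) + sumBelow k (λ i → n C suc i))  ≡⟨ cong suc (sumBelow-+ k (n C_) (λ i → n C suc i)) ⟨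
  suc (sumBelow k (λ i → n C i + n C suc i))              ≡⟨ cong suc (sumBelow-cong k (nCk+nC[k+1]≡[n+1]C[k+1] n)) ⟩
  suc (sumBelow k (λ i → suc n C suc i))                  ∎
  where open ≡-Reasoning

count-avoiders : ∀ {k} n (u : BinaryWord k) →
  count (not ∘ subsequenceᵇ _≟ᶠ_ u) (allWords n 2) ≡ sumBelow k (n C_)
count-avoiders         n       []      = count-false (allWords n 2)
count-avoiders {suc k} zero    (x ∷ u) = cong suc (sym (sumBelow-zeros k))
count-avoiders {suc k} (suc n) (x ∷ u) = begin
  #avoiders (suc n) (x ∷ u)                    ≡⟨ count-allWords-suc n _ ⟩
  #starting x 0F + #starting x 1F              ≡⟨ first-letter x ⟩
  #avoiders n u + #avoiders n (x ∷ u)          ≡⟨ cong₂ _+_ (count-avoiders n u) (count-avoiders n (x ∷ u)) ⟩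
  sumBelow k (n C_) + sumBelow (suc k) (n C_)  ≡⟨ pascal-sumBelow n k ⟩
  sumBelow (suc k) (suc n C_)                  ∎
  where
  open ≡-Reasoning
  #avoiders : ∀ m {j} → BinaryWord j → ℕ
  #avoiders m v = count (not ∘ subsequenceᵇ _≟ᶠ_ v) (allWords m 2)
  #starting : Fin 2 → Fin 2 → ℕ
  #starting y c = count (not ∘ subsequenceᵇ _≟ᶠ_ (y ∷ u) ∘ (c ∷_)) (allWords n 2)
  first-letter : ∀ y → #starting y 0F + #starting y 1F ≡ #avoiders n u + #avoiders n (y ∷ u)
  first-letter 0F = refl
  first-letter 1F = +-comm (#avoiders n (1F ∷ u)) (#avoiders n u)

sumBelow-binomial-split : ∀ n m → sumBelow (3 + m) (n C_) ≡ 1 + sumFromTo 3 (3 + m) (λ j → n C (j ∸ 1)) + n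
sumBelow-binomial-split n m = begin
  suc (n C 1 + S)  ≡⟨ cong (λ x → suc (x + S)) (nC1≡n n) ⟩
  suc (n + S)      ≡⟨ cong suc (+-comm n S) ⟩
  suc (S + n)      ≡⟨ cong (λ x → suc (x + n)) (sumFromTo≡sumBelow 3 (3 + m) (λ j → n C (j ∸ 1))) ⟨
  1 + sumFromTo 3 (3 + m) (λ j → n C (j ∸ 1)) + n ∎
  where
  open ≡-Reasoning
  S : ℕ
  S = sumBelow (suc m) (λ i → n C (2 + i))

module CountingAvoiders {k} {σ : Word k k} {u : BinaryWord k} (σ-perm : IsPerm σ) (σ-sorted : Sorted u σ)
                        (u-unsorted : Unsorted u) (n : ℕ) where

  avoidsᵇ : BinaryWord n → Bool
  avoidsᵇ ℓ = not (subsequenceᵇ _≟ᶠ_ u ℓ)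

  avoiding-canonicalᵇ : BinaryWord n → Bool
  avoiding-canonicalᵇ ℓ = avoidsᵇ ℓ ∧ canonicalᵇ ℓ

  labellings : List (BinaryWord n)
  labellings = filter (T? ∘ avoiding-canonicalᵇ) (allWords n 2)

  ∈-labellings⁻ : ∀ {ℓ} → ℓ ∈ labellings → ¬ u ⊑ ℓ × Canonical ℓ
  ∈-labellings⁻ {ℓ} ℓ∈ =
    let avoids , canonical = Equivalence.to (T-∧ {avoidsᵇ ℓ})
                               (proj₂ (∈-filter⁻ (T? ∘ avoiding-canonicalᵇ) {xs = allWords n 2} ℓ∈))
    in T-not⇒¬T avoids ∘ ⊑⇒subsequenceᵇ _≟ᶠ_ u ℓ , canonicalᵇ-sound ℓ canonical

  ∈-labellings⁺ : ∀ {ℓ} → ¬ u ⊑ ℓ → Canonical ℓ → ℓ ∈ labellings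
  ∈-labellings⁺ {ℓ} ¬u⊑ℓ canonical = ∈-filter⁺ (T? ∘ avoiding-canonicalᵇ) (allWords-complete ℓ)
    (Equivalence.from (T-∧ {avoidsᵇ ℓ})
      (¬T⇒T-not (¬u⊑ℓ ∘ subsequenceᵇ⇒⊑ _≟ᶠ_ u ℓ) , canonicalᵇ-complete ℓ canonical))

  sortBy-∈-Gnσ : ∀ {ℓ} → ℓ ∈ labellings → sortBy ℓ ∈ Gnσ n σ
  sortBy-∈-Gnσ {ℓ} ℓ∈ = ∈-filter⁺ (inGnσ? σ) (allWords-complete (sortBy ℓ))
    ( sortBy-perm ℓ
    , sorted⇒grassmannian (sortBy-sorted ℓ)
    , proj₁ (∈-labellings⁻ ℓ∈) ∘ contains⇒⊑ σ-perm σ-sorted (sortBy-perm ℓ) (sortBy-sorted ℓ) u-unsorted)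

  Gnσ-sortBy : ∀ {π} → π ∈ Gnσ n σ → ∃ λ ℓ → ℓ ∈ labellings × sortBy ℓ ≡ π
  Gnσ-sortBy {π} π∈ =
    let π-perm , grassmannian , avoids = proj₂ (∈-filter⁻ (inGnσ? σ) {xs = allWords n n} π∈)
        ℓ , π-sorted , canonical = canonicalise (proj₂ (grassmannian⇒sorted π π-perm grassmannian))
    in ℓ , ∈-labellings⁺ (avoids ∘ ⊑⇒contains σ-perm σ-sorted π-perm π-sorted) canonical
         , sorted-unique _ _ (sortBy-perm ℓ) π-perm (sortBy-sorted ℓ) π-sorted

  length-Gnσ : length (Gnσ n σ) ≡ count avoiding-canonicalᵇ (allWords n 2)
  length-Gnσ = trans
    (sym (length-≡-by-bijection sortBy (filter⁺ (T? ∘ avoiding-canonicalᵇ) (allWords-unique n 2))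
      (filter⁺ (inGnσ? σ) (allWords-unique n n))
      (λ ℓ∈ ℓ′∈ → sortBy-injective (proj₂ (∈-labellings⁻ ℓ∈)) (proj₂ (∈-labellings⁻ ℓ′∈)))
      sortBy-∈-Gnσ Gnσ-sortBy))
    (length-filter≡count avoiding-canonicalᵇ (allWords n 2))

  noncanonical⇒avoids : ∀ ℓ → avoidsᵇ ℓ ∧ not (canonicalᵇ ℓ) ≡ not (canonicalᵇ ℓ)
  noncanonical⇒avoids ℓ with canonicalᵇ ℓ in noncanonical
  ... | true  = ∧-zeroʳ _
  ... | false with subsequenceᵇ _≟ᶠ_ u ℓ in u⊑ℓ
  ...   | false = refl
  ...   | true  = contradiction
    (canonicalᵇ-complete ℓ (inj₁ (⊑-unsorted u-unsorted
      (subsequenceᵇ⇒⊑ _≟ᶠ_ u ℓ (subst T (sym u⊑ℓ) _)))))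
    (subst T noncanonical)

  count-avoiding-canonical : count avoiding-canonicalᵇ (allWords n 2) + n ≡ sumBelow k (n C_)
  count-avoiding-canonical = begin
    count avoiding-canonicalᵇ ws + n
      ≡⟨ cong (count avoiding-canonicalᵇ ws +_)
           (trans (count-cong ws noncanonical⇒avoids) (count-noncanonical n)) ⟨
    count avoiding-canonicalᵇ ws + count (λ ℓ → avoidsᵇ ℓ ∧ not (canonicalᵇ ℓ)) ws
      ≡⟨ count-∧-split avoidsᵇ canonicalᵇ ws ⟨
    count avoidsᵇ ws
      ≡⟨ count-avoiders n u ⟩
    sumBelow k (n C_) ∎
    where
    open ≡-Reasoning
    ws : List (BinaryWord n)
    ws = allWords n 2

mainTheorem6 : ∀ (k : ℕ) → 3 ≤ k → (σ : Word k k) → IsPerm σ → des σ ≡ 1 →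
    ∀ (n : ℕ) → length (Gnσ n σ) ≡ 1 + sumFromTo 3 k (λ j → n C (j ∸ 1))
mainTheorem6 k@(suc (suc (suc m))) (s≤s (s≤s (s≤s _))) σ σ-perm des≡1 n = +-cancelʳ-≡ n _ _ (begin
  length (Gnσ n σ) + n                                  ≡⟨ cong (_+ n) length-Gnσ ⟩
  count avoiding-canonicalᵇ (allWords n 2) + n          ≡⟨ count-avoiding-canonical ⟩
  sumBelow k (n C_)                                     ≡⟨ sumBelow-binomial-split n m ⟩
  1 + sumFromTo 3 k (λ j → n C (j ∸ 1)) + n             ∎)
  where
  open ≡-Reasoning
  σ-sortable : ∃ λ u → Sorted u σ
  σ-sortable = grassmannian⇒sorted σ σ-perm (≤-reflexive des≡1)
  u-unsorted : Unsorted (proj₁ σ-sortable)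
  u-unsorted = descent⇒unsorted (proj₂ σ-sortable) (proj₂ (des≡1⇒descent σ des≡1))
  open CountingAvoiders σ-perm (proj₂ σ-sortable) u-unsorted n
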